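{- Let $\pi_1,\dots,\pi_T \in S_n$ be the list of guesses of a correct static strategy for permutation Mastermind. Let $U_T$ be the bipartite graph with vertex classes $[n]$ (positions) and $\Sigma = \{s_1,\dots,s_n\}$ (symbols) in which $\{i, s_j\}$ is an edge if and only if $\pi_r(i) \neq j$ for every $1 \le r \le T$. Then $U_T$ contains no $K_{2,2}$, i.e. there are no $i \neq i'$ in $[n]$ and $x \neq y$ in $[n]$ such that $\{i,s_x\},\{i,s_y\},\{i',s_x\},\{i',s_y\}$ are all edges of $U_T$.
   Context: Black-peg score: $b(\pi,\sigma) := |\{i\in[n] : \pi(i)=\sigma(i)\}|$ for $\pi,\sigma\in S_n$. A static strategy is a fixed list $(\pi_1,\dots,\pi_T)$ of guesses; the codemaker reveals $b(\pi_1,\sigma^\star),\dots,b(\pi_T,\sigma^\star)$ for the secret $\sigma^\star\in S_n$, and then the codebreaker makes one final guess. The strategy is correct if this final guess always equals $\sigma^\star$; equivalently, for every $\sigma^\star\in S_n$, $\sigma^\star$ is the only $\sigma \in S_n$ with $b(\pi_t,\sigma)=b(\pi_t,\sigma^\star)$ for all $1\le t\le T$. -}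

module Defs where

open import Data.Nat using (ℕ)
open import Data.Fin using (Fin; _≟_)
open import Data.List using (length; filter)
open import Data.List.Base using (allFin)
open import Data.Fin.Permutation using (Permutation′; _⟨$⟩ʳ_; _≈_)
open import Relation.Binary.PropositionalEquality using (_≡_; _≢_)
open import Data.Product using (_×_; ∃-syntax)

blackPeg : {n : ℕ} → Permutation′ n → Permutation′ n → ℕ
blackPeg {n} π σ = length (filter (λ i → (π ⟨$⟩ʳ i) ≟ (σ ⟨$⟩ʳ i)) (allFin n))

Strategy : ℕ → ℕ → Set
Strategy n T = Fin T → Permutation′ n

Correct : {n T : ℕ} → Strategy n T → Set
Correct {n} {T} π = (σ⋆ σ : Permutation′ n) →
  ((t : Fin T) → blackPeg (π t) σ ≡ blackPeg (π t) σ⋆) → σ ≈ σ⋆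

UEdge : {n T : ℕ} → Strategy n T → Fin n → Fin n → Set
UEdge {n} {T} π i j = (r : Fin T) → π r ⟨$⟩ʳ i ≢ j

HasK22 : {n T : ℕ} → Strategy n T → Set
HasK22 π = ∃[ i ] ∃[ i′ ] ∃[ x ] ∃[ y ]
  (i ≢ i′ × x ≢ y × UEdge π i x × UEdge π i y × UEdge π i′ x × UEdge π i′ y)

{-# OPTIONS --safe #-}
module Submission where

open import Defs
open import Data.Nat using (ℕ)
open import Data.Fin using (Fin; _≟_)
open import Data.Fin.Permutation
  using (Permutation′; _⟨$⟩ʳ_; _∘ₚ_; transpose)
open import Data.List using (length; allFin)
open import Data.List.Properties using (filter-≐)
open import Data.Product using (_×_; _,_; ∃-syntax)
open import Data.Sum using (_⊎_; inj₁; inj₂)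
open import Data.Empty using (⊥-elim)
open import Function using (Injection; _⇔_; mk⇔; Equivalence)
open import Function.Properties.Inverse using (↔⇒↣)
open import Level using (0ℓ)
open import Relation.Nullary using (¬_; Dec; yes; no)
open import Relation.Unary using (Pred; _≐_)
open import Relation.Binary.PropositionalEquality
  using (_≡_; _≢_; refl; sym; trans; cong; module ≡-Reasoning)

-- If the secret σ⋆ places x at i and y at i′, and no guess ever places x or y
-- at i or i′, then swapping the symbols x and y in σ⋆ changes none of the
-- black-peg scores, so the strategy cannot tell the two secrets apart.  Such
-- a σ⋆ exists whenever i ≢ i′ and x ≢ y, which is exactly a K₂,₂ in U_T.

private
  variable
    n : ℕ

permutation-injective : (σ : Permutation′ n) {k k′ : Fin n} →
                        σ ⟨$⟩ʳ k ≡ σ ⟨$⟩ʳ k′ → k ≡ k′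
permutation-injective σ = Injection.injective (↔⇒↣ σ)

transpose-matchˡ : (i j : Fin n) → transpose i j ⟨$⟩ʳ i ≡ j
transpose-matchˡ i j with i ≟ i
... | yes _   = refl
... | no i≢i = ⊥-elim (i≢i refl)

transpose-matchʳ : (i j : Fin n) → transpose i j ⟨$⟩ʳ j ≡ i
transpose-matchʳ i j with j ≟ i
... | yes j≡i = j≡i
... | no _ with j ≟ j
...   | yes _   = refl
...   | no j≢j = ⊥-elim (j≢j refl)

transpose-fixes : (i j : Fin n) {k : Fin n} → k ≢ i → k ≢ j →
                  transpose i j ⟨$⟩ʳ k ≡ k
transpose-fixes i j {k} k≢i k≢j with k ≟ i
... | yes k≡i = ⊥-elim (k≢i k≡i)
... | no _ with k ≟ j
...   | yes k≡j = ⊥-elim (k≢j k≡j)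
...   | no _    = refl

∃-permutation-mapping₂ : {i i′ x y : Fin n} → i ≢ i′ → x ≢ y →
                         ∃[ σ ] (σ ⟨$⟩ʳ i ≡ x × σ ⟨$⟩ʳ i′ ≡ y)
∃-permutation-mapping₂ {i = i} {i′} {x} {y} i≢i′ x≢y =
  ρ ∘ₚ transpose z y , σi≡x , transpose-matchˡ z y
  where
  ρ : Permutation′ _
  ρ = transpose i x
  z : Fin _
  z = ρ ⟨$⟩ʳ i′
  x≢z : x ≢ z
  x≢z x≡z = i≢i′ (permutation-injective ρ (trans (transpose-matchˡ i x) x≡z))
  σi≡x : transpose z y ⟨$⟩ʳ (ρ ⟨$⟩ʳ i) ≡ x
  σi≡x = trans (cong (transpose z y ⟨$⟩ʳ_) (transpose-matchˡ i x))
               (transpose-fixes z y x≢z x≢y)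

≡⇔≡-transpose : {x y a b : Fin n} → (a ≡ x ⊎ a ≡ y → b ≢ x × b ≢ y) →
                b ≡ a ⇔ b ≡ transpose x y ⟨$⟩ʳ a
≡⇔≡-transpose {x = x} {y} {a} {b} avoid = byCases (a ≟ x) (a ≟ y)
  where
  byCases : Dec (a ≡ x) → Dec (a ≡ y) → b ≡ a ⇔ b ≡ transpose x y ⟨$⟩ʳ a
  byCases (yes refl) _ =
    let b≢x , b≢y = avoid (inj₁ refl)
    in mk⇔ (λ b≡x → ⊥-elim (b≢x b≡x))
           (λ b≡y → ⊥-elim (b≢y (trans b≡y (transpose-matchˡ x y))))
  byCases (no _) (yes refl) =
    let b≢x , b≢y = avoid (inj₂ refl)
    in mk⇔ (λ b≡y → ⊥-elim (b≢y b≡y))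
           (λ b≡x → ⊥-elim (b≢x (trans b≡x (transpose-matchʳ x y))))
  byCases (no a≢x) (no a≢y) =
    let fixed = transpose-fixes x y a≢x a≢y
    in mk⇔ (λ b≡a → trans b≡a (sym fixed)) (λ b≡a′ → trans b≡a′ fixed)

Matches : Permutation′ n → Permutation′ n → Pred (Fin n) 0ℓ
Matches π σ k = π ⟨$⟩ʳ k ≡ σ ⟨$⟩ʳ k

blackPeg-cong : (π σ σ′ : Permutation′ n) →
                Matches π σ ≐ Matches π σ′ → blackPeg π σ ≡ blackPeg π σ′
blackPeg-cong {n} π σ σ′ same =
  cong length (filter-≐ (λ k → π ⟨$⟩ʳ k ≟ σ ⟨$⟩ʳ k)
                        (λ k → π ⟨$⟩ʳ k ≟ σ′ ⟨$⟩ʳ k) same (allFin n))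

blackPeg-transpose : (π σ : Permutation′ n) {x y : Fin n} →
  (∀ k → σ ⟨$⟩ʳ k ≡ x ⊎ σ ⟨$⟩ʳ k ≡ y → π ⟨$⟩ʳ k ≢ x × π ⟨$⟩ʳ k ≢ y) →
  blackPeg π (σ ∘ₚ transpose x y) ≡ blackPeg π σ
blackPeg-transpose π σ {x} {y} avoid =
  blackPeg-cong π (σ ∘ₚ transpose x y) σ
    ((λ {k} → Equivalence.from (matches⇔ k)) , (λ {k} → Equivalence.to (matches⇔ k)))
  where
  matches⇔ : ∀ k → Matches π σ k ⇔ Matches π (σ ∘ₚ transpose x y) k
  matches⇔ k = ≡⇔≡-transpose (avoid k)

lemma11 : (n T : ℕ) (π : Strategy n T) → Correct π → ¬ HasK22 π
lemma11 n T π correct (i , i′ , x , y , i≢i′ , x≢y , ix , iy , i′x , i′y)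
  with ∃-permutation-mapping₂ i≢i′ x≢y
... | σ , σi≡x , σi′≡y = x≢y (begin
    x                              ≡⟨ sym σi≡x ⟩
    σ ⟨$⟩ʳ i                       ≡⟨ sym (correct σ σ′ sameScores i) ⟩
    transpose x y ⟨$⟩ʳ (σ ⟨$⟩ʳ i)  ≡⟨ cong (transpose x y ⟨$⟩ʳ_) σi≡x ⟩
    transpose x y ⟨$⟩ʳ x           ≡⟨ transpose-matchˡ x y ⟩
    y                              ∎)
  where
  open ≡-Reasoning
  σ′ : Permutation′ n
  σ′ = σ ∘ₚ transpose x y
  avoid : ∀ t k → σ ⟨$⟩ʳ k ≡ x ⊎ σ ⟨$⟩ʳ k ≡ y →
          π t ⟨$⟩ʳ k ≢ x × π t ⟨$⟩ʳ k ≢ y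
  avoid t k (inj₁ σk≡x) with refl ← permutation-injective σ (trans σk≡x (sym σi≡x)) =
    ix t , iy t
  avoid t k (inj₂ σk≡y) with refl ← permutation-injective σ (trans σk≡y (sym σi′≡y)) =
    i′x t , i′y t
  sameScores : ∀ t → blackPeg (π t) σ′ ≡ blackPeg (π t) σ
  sameScores t = blackPeg-transpose (π t) σ (avoid t)
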